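{- Let $T=\{123,132,213\}$, $k\geq 1$, and let $\tau\in S_k(T)$ with $\tau\neq(k,k-1,\dots,1)$. Then either $\tau=(k,\tau')$ for some $\tau'\in S_{k-1}(T)$ (i.e. $\tau_1=k$ and $(\tau_2,\dots,\tau_k)$ avoids $T$), and in that case $$|S_n(T,\tau)|=|S_{n-1}(T,\tau')|+|S_{n-2}(T,\tau')|\quad\text{for all } n\geq k;$$ or $\tau=(k-1,k,\tau'')$ for some $\tau''\in S_{k-2}(T)$ (i.e. $\tau_1=k-1$, $\tau_2=k$ and $(\tau_3,\dots,\tau_k)$ avoids $T$), and in that case $$|S_n(T,\tau)|=|S_{n-1}(T,\tau)|+|S_{n-2}(T,\tau'')|\quad\text{for all } n\geq k.$$
   Context: Permutations are written in one-line notation; $S_k$ is the set of permutations of $\{1,\dots,k\}$, $S_0$ consists of the empty permutation (the empty pattern is contained in every permutation). A permutation $\alpha\in S_n$ contains a pattern $\beta$ if some subsequence of $\alpha$ is order-isomorphic to $\beta$; otherwise it avoids $\beta$. For a set $T$ of patterns and a pattern $\tau$, $S_n(T,\tau)$ is the set of permutations in $S_n$ avoiding every pattern of $T$ and $\tau$. -}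

module Defs where

open import Data.Nat using (ℕ; zero; suc; _<_; _≤_; _<?_; _≤?_; _≟_)
open import Data.Nat.Properties using (≡-irrelevant)
open import Data.Fin using (Fin; cast)
open import Data.Fin.Properties using () renaming (all? to allFin?)
open import Data.List using (List; []; _∷_; length; lookup; map; _++_; concatMap; upTo; filter)
open import Data.List.Relation.Unary.All using (All; all?)
open import Data.List.Relation.Unary.Any using (Any; any?)
open import Data.List.Relation.Unary.Unique.Propositional using (Unique)
import Data.List.Relation.Unary.Unique.DecPropositional as UD
open import Data.Product using (Σ; _×_; _,_)
open import Relation.Nullary using (¬_; Dec; yes; no; ¬?)
open import Relation.Nullary.Decidable using (_×-dec_)
open import Relation.Binary.PropositionalEquality using (_≡_; refl)
open import Data.Empty using (⊥-elim)

-- A permutation of length n in one-line notation is a list of naturals.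

_⟺_ : Set → Set → Set
A ⟺ B = (A → B) × (B → A)

_⟺?_ : {A B : Set} → Dec A → Dec B → Dec (A ⟺ B)
yes a ⟺? yes b = yes ((λ _ → b) , (λ _ → a))
yes a ⟺? no ¬b = no (λ f → ¬b (Data.Product.proj₁ f a))
no ¬a ⟺? yes b = no (λ f → ¬a (Data.Product.proj₂ f b))
no ¬a ⟺? no ¬b = yes ((λ a → ⊥-elim (¬a a)) , (λ b → ⊥-elim (¬b b)))

OrderIso : List ℕ → List ℕ → Set
OrderIso xs ys =
  Σ (length xs ≡ length ys) λ eq →
    (i j : Fin (length xs)) →
      (lookup xs i < lookup xs j) ⟺ (lookup ys (cast eq i) < lookup ys (cast eq j))

orderIso? : (xs ys : List ℕ) → Dec (OrderIso xs ys)
orderIso? xs ys with length xs ≟ length ys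
... | no ne = no (λ { (eq , _) → ne eq })
... | yes eq with allFin? (λ i → allFin? (λ j →
                   (lookup xs i <? lookup xs j) ⟺? (lookup ys (cast eq i) <? lookup ys (cast eq j))))
...   | yes p = yes (eq , p)
...   | no ¬p = no (λ { (eq′ , p) → ¬p p })

subseqs : List ℕ → List (List ℕ)
subseqs [] = [] ∷ []
subseqs (x ∷ xs) = map (x ∷_) (subseqs xs) ++ subseqs xs

Contains : List ℕ → List ℕ → Set
Contains α β = Any (λ s → OrderIso s β) (subseqs α)

contains? : (α β : List ℕ) → Dec (Contains α β)
contains? α β = any? (λ s → orderIso? s β) (subseqs α)

AvoidsAll : List (List ℕ) → List ℕ → Set
AvoidsAll T α = All (λ β → ¬ Contains α β) T

avoidsAll? : (T : List (List ℕ)) (α : List ℕ) → Dec (AvoidsAll T α)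
avoidsAll? T α = all? (λ β → ¬? (contains? α β)) T

IsPerm : ℕ → List ℕ → Set
IsPerm n α = (length α ≡ n) × All (λ x → 1 ≤ x × x ≤ n) α × Unique α

isPerm? : (n : ℕ) (α : List ℕ) → Dec (IsPerm n α)
isPerm? n α = (length α ≟ n) ×-dec (all? (λ x → (1 ≤? x) ×-dec (x ≤? n)) α ×-dec UD.unique? _≟_ α)

InS : ℕ → List (List ℕ) → List ℕ → Set
InS n T α = IsPerm n α × AvoidsAll T α

inS? : (n : ℕ) (T : List (List ℕ)) (α : List ℕ) → Dec (InS n T α)
inS? n T α = isPerm? n α ×-dec avoidsAll? T α

words : ℕ → ℕ → List (List ℕ)
words n zero = [] ∷ []
words n (suc m) = concatMap (λ w → map (λ a → suc a ∷ w) (upTo n)) (words n m)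

-- |S_n(T)| : the number of permutations of length n avoiding all of T
-- (counted among all words of length n over {1,…,n}, which contain S_n).
countS : ℕ → List (List ℕ) → ℕ
countS n T = length (filter (inS? n T) (words n n))

T₀ : List (List ℕ)
T₀ = (1 ∷ 2 ∷ 3 ∷ []) ∷ (1 ∷ 3 ∷ 2 ∷ []) ∷ (2 ∷ 1 ∷ 3 ∷ []) ∷ []

decreasing : ℕ → List ℕ
decreasing zero = []
decreasing (suc k) = suc k ∷ decreasing k

-- A T₀-avoiding permutation of length n ≥ 2 begins with n or with (n−1, n): two entries followed
-- later by a larger one form 123 or 213, and if n comes second, a first entry below n−1 forms 132
-- with n and n−1. Conversely, prefixing n, or (n−1, n), to a T₀-avoider keeps it T₀-avoiding, since
-- every pattern of T₀ ends above its first entry. So S_n(T, τ) is the disjoint union of the n·σ with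
-- σ ∈ S_{n−1}(T) and the (n−1)·n·σ with σ ∈ S_{n−2}(T) that avoid τ, and it remains to compare
-- occurrences of τ with occurrences in σ. For τ = (k, τ′), both n·σ and (n−1)·n·σ contain τ iff σ
-- contains τ′: n can play k, and the ascent (n−1, n) cannot be matched to k followed by a smaller
-- entry. For τ = (k−1, k, τ″), the ascent at the start of τ cannot begin at the maximum n, so n·σ
-- contains τ iff σ does, while (n−1)·n·σ contains τ iff σ contains τ″.

module Submission where

open import Defs
open import Data.Nat using (ℕ; zero; suc; _+_; _<_; _≤_; _≥_; _∸_; z≤n; s≤s; z<s; s<s)
open import Data.Nat.Properties
open import Data.Fin using () renaming (zero to fzero; suc to fsuc)
open import Data.List using (List; []; _∷_; length; map; _++_; upTo; filter; drop)
open import Data.List.Properties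
  using (length-map; length-++; length-upTo; length-removeAt′; ∷-injectiveˡ; ∷-injectiveʳ)
open import Data.List.Relation.Unary.All as All using (All; []; _∷_)
open import Data.List.Relation.Unary.All.Properties using (drop⁺) renaming (map⁺ to All-map⁺)
open import Data.List.Relation.Unary.Any using (here; there; index; _─_)
open import Data.List.Relation.Unary.AllPairs as AllPairs using ([]; _∷_)
import Data.List.Relation.Unary.AllPairs.Properties as AllPairsₚ
open import Data.List.Relation.Unary.Unique.Propositional using (Unique)
import Data.List.Relation.Unary.Unique.Propositional.Properties as Unique
open import Data.List.Relation.Binary.Pointwise as Pointwise using (Pointwise; []; _∷_)
open import Data.List.Relation.Binary.Sublist.Propositional using (_⊆_; []; _∷_; _∷ʳ_; from∈)
open import Data.List.Relation.Binary.Sublist.Propositional.Properties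
  using (∷ˡ⁻; ∷⁻; All-resp-⊆)
open import Data.List.Membership.Propositional using (_∈_; lose; find)
open import Data.List.Membership.Propositional.Properties
open import Data.List.Membership.DecPropositional _≟_ using (_∈?_)
open import Data.Product using (Σ; _×_; _,_; proj₁; proj₂)
open import Data.Sum using (_⊎_; inj₁; inj₂; [_,_]′)
open import Data.Empty using (⊥-elim)
open import Function using (_∘_)
open import Relation.Nullary using (¬_; contradiction)
open import Relation.Nullary.Decidable using (decidable-stable)
open import Relation.Binary.Definitions using (tri<; tri≈; tri>)
open import Relation.Binary.PropositionalEquality

∈-─⁺ : ∀ {A : Set} {x v : A} {xs} (x∈xs : x ∈ xs) → v ∈ xs → v ≢ x → v ∈ (xs ─ x∈xs)
∈-─⁺ (here refl) (here refl) v≢x = contradiction refl v≢x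
∈-─⁺ (here refl) (there v∈xs) _ = v∈xs
∈-─⁺ (there x∈xs) (here refl) _ = here refl
∈-─⁺ (there x∈xs) (there v∈xs) v≢x = there (∈-─⁺ x∈xs v∈xs v≢x)

unique⇒length≤ : ∀ {A : Set} {xs ys : List A} → Unique xs → (∀ {v} → v ∈ xs → v ∈ ys) →
  length xs ≤ length ys
unique⇒length≤ {xs = []} _ _ = z≤n
unique⇒length≤ {xs = x ∷ xs} {ys} (x∉xs ∷ xs!) xs⊆ys = begin
  suc (length xs)          ≤⟨ s≤s (unique⇒length≤ xs! xs⊆ys─x) ⟩
  suc (length (ys ─ x∈ys)) ≡⟨ length-removeAt′ ys (index x∈ys) ⟨
  length ys                ∎
  where
  open ≤-Reasoning
  x∈ys = xs⊆ys (here refl)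
  xs⊆ys─x : ∀ {v} → v ∈ xs → v ∈ (ys ─ x∈ys)
  xs⊆ys─x v∈xs = ∈-─⁺ x∈ys (xs⊆ys (there v∈xs)) (All.lookup x∉xs v∈xs ∘ sym)

unique⇒length≡ : ∀ {A : Set} {xs ys : List A} → Unique xs → Unique ys →
  (∀ {v} → (v ∈ xs) ⟺ (v ∈ ys)) → length xs ≡ length ys
unique⇒length≡ xs! ys! xs⇔ys =
  ≤-antisym (unique⇒length≤ xs! (proj₁ xs⇔ys)) (unique⇒length≤ ys! (proj₂ xs⇔ys))

words-complete : ∀ n {α} → All (λ x → 1 ≤ x × x ≤ n) α → α ∈ words n (length α)
words-complete n [] = here refl
words-complete n {suc a ∷ α} ((_ , a≤n) ∷ bounds) =
  ∈-concatMap⁺ (λ w → map (λ b → suc b ∷ w) (upTo n))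
    (lose (words-complete n bounds) (∈-map⁺ (λ b → suc b ∷ α) (∈-upTo⁺ a≤n)))

words-unique : ∀ n m → Unique (words n m)
words-unique n zero = [] ∷ []
words-unique n (suc m) =
  Unique.concat⁺
    (All-map⁺ (All.tabulate (λ {w} _ → Unique.map⁺ (suc-∷-injective {w}) (Unique.upTo⁺ n))))
    (AllPairsₚ.map⁺ (AllPairs.map disjoint (words-unique n m)))
  where
  suc-∷-injective : ∀ {w a b} → suc a ∷ w ≡ suc b ∷ w → a ≡ b
  suc-∷-injective refl = refl
  disjoint : ∀ {w w′} → w ≢ w′ → ∀ {v} →
    ¬ (v ∈ map (λ a → suc a ∷ w) (upTo n) × v ∈ map (λ a → suc a ∷ w′) (upTo n))
  disjoint w≢w′ (v∈ , v∈′) with ∈-map⁻ _ v∈ | ∈-map⁻ _ v∈′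
  ... | _ , _ , refl | _ , _ , eq = w≢w′ (∷-injectiveʳ eq)

S : ℕ → List (List ℕ) → List (List ℕ)
S n T = filter (inS? n T) (words n n)

∈-S⁺ : ∀ {n T α} → InS n T α → α ∈ S n T
∈-S⁺ {n} {T} α∈S@((refl , bounds , _) , _) = ∈-filter⁺ (inS? n T) (words-complete n bounds) α∈S

∈-S⁻ : ∀ {n T α} → α ∈ S n T → InS n T α
∈-S⁻ {n} {T} α∈ = proj₂ (∈-filter⁻ (inS? n T) {xs = words n n} α∈)

S-unique : ∀ n T → Unique (S n T)
S-unique n T = Unique.filter⁺ (inS? n T) (words-unique n n)

count-split : ∀ {n n₁ n₂ T T₁ T₂} (f g : List ℕ → List ℕ) →
  (∀ {σ τ} → f σ ≡ f τ → σ ≡ τ) → (∀ {σ τ} → g σ ≡ g τ → σ ≡ τ) → (∀ {σ τ} → f σ ≢ g τ) →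
  (∀ {α} → InS n T α ⟺ ((Σ (List ℕ) λ σ → α ≡ f σ × InS n₁ T₁ σ)
                       ⊎ (Σ (List ℕ) λ σ → α ≡ g σ × InS n₂ T₂ σ))) →
  countS n T ≡ countS n₁ T₁ + countS n₂ T₂
count-split {n} {n₁} {n₂} {T} {T₁} {T₂} f g f-injective g-injective f≢g split = begin
  length (S n T)
    ≡⟨ unique⇒length≡ (S-unique n T) images-unique (to , from) ⟩
  length (map f (S n₁ T₁) ++ map g (S n₂ T₂))
    ≡⟨ length-++ (map f (S n₁ T₁)) ⟩
  length (map f (S n₁ T₁)) + length (map g (S n₂ T₂))
    ≡⟨ cong₂ _+_ (length-map f (S n₁ T₁)) (length-map g (S n₂ T₂)) ⟩
  length (S n₁ T₁) + length (S n₂ T₂)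
    ∎
  where
  open ≡-Reasoning
  images-unique : Unique (map f (S n₁ T₁) ++ map g (S n₂ T₂))
  images-unique =
    Unique.++⁺ (Unique.map⁺ f-injective (S-unique n₁ T₁)) (Unique.map⁺ g-injective (S-unique n₂ T₂))
               disjoint-images
    where
    disjoint-images : ∀ {v} → ¬ (v ∈ map f (S n₁ T₁) × v ∈ map g (S n₂ T₂))
    disjoint-images (v∈f , v∈g) with ∈-map⁻ f v∈f | ∈-map⁻ g v∈g
    ... | _ , _ , refl | _ , _ , eq = f≢g eq
  to : ∀ {α} → α ∈ S n T → α ∈ map f (S n₁ T₁) ++ map g (S n₂ T₂)
  to α∈ with proj₁ split (∈-S⁻ α∈)
  ... | inj₁ (σ , refl , σ∈) = ∈-++⁺ˡ (∈-map⁺ f (∈-S⁺ σ∈))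
  ... | inj₂ (σ , refl , σ∈) = ∈-++⁺ʳ (map f (S n₁ T₁)) (∈-map⁺ g (∈-S⁺ σ∈))
  from : ∀ {α} → α ∈ map f (S n₁ T₁) ++ map g (S n₂ T₂) → α ∈ S n T
  from α∈ with ∈-++⁻ (map f (S n₁ T₁)) α∈
  ... | inj₁ α∈f with ∈-map⁻ f α∈f
  ...   | σ , σ∈ , refl = ∈-S⁺ (proj₂ split (inj₁ (σ , refl , ∈-S⁻ σ∈)))
  from α∈ | inj₂ α∈g with ∈-map⁻ g α∈g
  ...   | σ , σ∈ , refl = ∈-S⁺ (proj₂ split (inj₂ (σ , refl , ∈-S⁻ σ∈)))

IsPerm⇒All< : ∀ {n σ} → IsPerm n σ → All (_< suc n) σ
IsPerm⇒All< (_ , bounds , _) = All.map (s≤s ∘ proj₂) bounds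

All<-trans : ∀ {x y xs} → All (_< x) xs → x < y → All (_< y) xs
All<-trans xs<x x<y = All.map (λ u<x → <-trans u<x x<y) xs<x

IsPerm-max∷⁻ : ∀ {n σ} → IsPerm (suc n) (suc n ∷ σ) → IsPerm n σ
IsPerm-max∷⁻ {n} (length≡ , _ ∷ bounds , max∉σ ∷ σ!) =
  suc-injective length≡ , All.zipWith lower (bounds , max∉σ) , σ!
  where
  lower : ∀ {x} → (1 ≤ x × x ≤ suc n) × suc n ≢ x → 1 ≤ x × x ≤ n
  lower ((1≤x , x≤1+n) , x≢1+n) = 1≤x , ≤-pred (≤∧≢⇒< x≤1+n (x≢1+n ∘ sym))

IsPerm-max∷⁺ : ∀ {n σ} → IsPerm n σ → IsPerm (suc n) (suc n ∷ σ)
IsPerm-max∷⁺ σ-perm@(length≡ , bounds , σ!) =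
  cong suc length≡ ,
  (s≤s z≤n , ≤-refl) ∷ All.map (λ (1≤x , x≤n) → 1≤x , m≤n⇒m≤1+n x≤n) bounds ,
  All.map (λ x<1+n → ≢-sym (<⇒≢ x<1+n)) (IsPerm⇒All< σ-perm) ∷ σ!

IsPerm-swap : ∀ {n x y σ} → IsPerm n (x ∷ y ∷ σ) → IsPerm n (y ∷ x ∷ σ)
IsPerm-swap (length≡ , bx ∷ by ∷ bounds , (x≢y ∷ x∉σ) ∷ y∉σ ∷ σ!) =
  length≡ , by ∷ bx ∷ bounds , (≢-sym x≢y ∷ y∉σ) ∷ x∉σ ∷ σ!

IsPerm-∈ : ∀ {n α v} → IsPerm n α → 1 ≤ v → v ≤ n → v ∈ α
IsPerm-∈ {n} {α} {v} (length≡ , bounds , α!) 1≤v v≤n = decidable-stable (v ∈? α) v∉α-impossible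
  where
  range = map suc (upTo n)
  ∈-range : ∀ {x} → 1 ≤ x → x ≤ n → x ∈ range
  ∈-range {suc x} _ x<n = ∈-map⁺ suc (∈-upTo⁺ x<n)
  v∈range = ∈-range 1≤v v≤n
  v∉α-impossible : ¬ ¬ v ∈ α
  v∉α-impossible v∉α = <-irrefl refl (begin-strict
    n                                ≡⟨ length≡ ⟨
    length α                         ≤⟨ unique⇒length≤ α! α⊆range─v ⟩
    length (range ─ v∈range)         <⟨ n<1+n _ ⟩
    suc (length (range ─ v∈range))   ≡⟨ length-removeAt′ range (index v∈range) ⟨
    length range                     ≡⟨ trans (length-map suc (upTo n)) (length-upTo n) ⟩
    n                                ∎)
    where
    open ≤-Reasoning
    α⊆range─v : ∀ {x} → x ∈ α → x ∈ (range ─ v∈range)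
    α⊆range─v x∈α = let (1≤x , x≤n) = All.lookup bounds x∈α in
      ∈-─⁺ v∈range (∈-range 1≤x x≤n) (λ { refl → v∉α x∈α })

IsPerm-1 : ∀ {α} → IsPerm 1 α → α ≡ 1 ∷ []
IsPerm-1 {x ∷ []} (_ , (1≤x , x≤1) ∷ [] , _) = cong (_∷ []) (≤-antisym x≤1 1≤x)

⟺-both : {A B : Set} → A → B → A ⟺ B
⟺-both a b = (λ _ → b) , (λ _ → a)

⟺-neither : {A B : Set} → ¬ A → ¬ B → A ⟺ B
⟺-neither ¬a ¬b = (λ a → contradiction a ¬a) , (λ b → contradiction b ¬b)

SameSide : ℕ → ℕ → ℕ → ℕ → Set
SameSide x y u v = ((u < x) ⟺ (v < y)) × ((x < u) ⟺ (y < v))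

below : ∀ {x y u v} → u < x → v < y → SameSide x y u v
below u<x v<y = ⟺-both u<x v<y , ⟺-neither (<-asym u<x) (<-asym v<y)

above : ∀ {x y u v} → x < u → y < v → SameSide x y u v
above x<u y<v = ⟺-neither (<-asym x<u) (<-asym y<v) , ⟺-both x<u y<v

below-all : ∀ {x y xs ys} → length xs ≡ length ys → All (_< x) xs → All (_< y) ys →
  Pointwise (SameSide x y) xs ys
below-all {xs = []} {[]} _ [] [] = []
below-all {xs = _ ∷ _} {_ ∷ _} length≡ (u<x ∷ xs<x) (v<y ∷ ys<y) =
  below u<x v<y ∷ below-all (suc-injective length≡) xs<x ys<y

orderIso-[] : OrderIso [] []
orderIso-[] = refl , λ ()

orderIso-∷ : ∀ {x y xs ys} → OrderIso xs ys → Pointwise (SameSide x y) xs ys →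
  OrderIso (x ∷ xs) (y ∷ ys)
orderIso-∷ (length≡ , iso) sides = cong suc length≡ , λ where
  fzero    fzero    → ⟺-neither (<-irrefl refl) (<-irrefl refl)
  fzero    (fsuc j) → proj₂ (Pointwise.lookup⁺ sides j)
  (fsuc i) fzero    → proj₁ (Pointwise.lookup⁺ sides i)
  (fsuc i) (fsuc j) → iso i j

orderIso-[_,_] : ∀ u v → OrderIso (u ∷ []) (v ∷ [])
orderIso-[ _ , _ ] = orderIso-∷ orderIso-[] []

orderIso-∷⁻ : ∀ {x y xs ys} → OrderIso (x ∷ xs) (y ∷ ys) → OrderIso xs ys
orderIso-∷⁻ (length≡ , iso) = suc-injective length≡ , λ i j → iso (fsuc i) (fsuc j)

orderIso-max∷ : ∀ {x y xs ys} → OrderIso xs ys → All (_< x) xs → All (_< y) ys →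
  OrderIso (x ∷ xs) (y ∷ ys)
orderIso-max∷ xs≅ys xs<x ys<y = orderIso-∷ xs≅ys (below-all (proj₁ xs≅ys) xs<x ys<y)

orderIso-123 : ∀ {a b c} → a < b → b < c → OrderIso (a ∷ b ∷ c ∷ []) (1 ∷ 2 ∷ 3 ∷ [])
orderIso-123 a<b b<c =
  orderIso-∷ (orderIso-∷ orderIso-[ _ , _ ] (above b<c (s<s (s<s z<s)) ∷ []))
             (above a<b (s<s z<s) ∷ above (<-trans a<b b<c) (s<s z<s) ∷ [])

orderIso-132 : ∀ {a b c} → a < c → c < b → OrderIso (a ∷ b ∷ c ∷ []) (1 ∷ 3 ∷ 2 ∷ [])
orderIso-132 a<c c<b =
  orderIso-∷ (orderIso-∷ orderIso-[ _ , _ ] (below c<b (s<s (s<s z<s)) ∷ []))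
             (above (<-trans a<c c<b) (s<s z<s) ∷ above a<c (s<s z<s) ∷ [])

orderIso-213 : ∀ {a b c} → b < a → a < c → OrderIso (a ∷ b ∷ c ∷ []) (2 ∷ 1 ∷ 3 ∷ [])
orderIso-213 b<a a<c =
  orderIso-∷ (orderIso-∷ orderIso-[ _ , _ ] (above (<-trans b<a a<c) (s<s z<s) ∷ []))
             (below b<a (s<s z<s) ∷ above a<c (s<s (s<s z<s)) ∷ [])

data Occurrence (α β : List ℕ) : Set where
  occurrence : ∀ {s} → s ⊆ α → OrderIso s β → Occurrence α β

∈-subseqs⁺ : ∀ {s α} → s ⊆ α → s ∈ subseqs α
∈-subseqs⁺ [] = here refl
∈-subseqs⁺ (refl ∷ s⊆α) = ∈-++⁺ˡ (∈-map⁺ _ (∈-subseqs⁺ s⊆α))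
∈-subseqs⁺ {α = x ∷ α} (_ ∷ʳ s⊆α) = ∈-++⁺ʳ (map (x ∷_) (subseqs α)) (∈-subseqs⁺ s⊆α)

∈-subseqs⁻ : ∀ {s} α → s ∈ subseqs α → s ⊆ α
∈-subseqs⁻ [] (here refl) = []
∈-subseqs⁻ (x ∷ α) s∈ with ∈-++⁻ (map (x ∷_) (subseqs α)) s∈
... | inj₂ s∈′ = x ∷ʳ ∈-subseqs⁻ α s∈′
... | inj₁ s∈′ with ∈-map⁻ (x ∷_) s∈′
...   | _ , t∈ , refl = refl ∷ ∈-subseqs⁻ α t∈

Contains⇒Occurrence : ∀ {α β} → Contains α β → Occurrence α β
Contains⇒Occurrence {α} c with find c
... | _ , s∈ , s≅β = occurrence (∈-subseqs⁻ α s∈) s≅β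

Occurrence⇒Contains : ∀ {α β} → Occurrence α β → Contains α β
Occurrence⇒Contains (occurrence s⊆α s≅β) = lose (∈-subseqs⁺ s⊆α) s≅β

Contains-⟺ : ∀ {α β α′ β′} → Occurrence α β ⟺ Occurrence α′ β′ → Contains α β ⟺ Contains α′ β′
Contains-⟺ (to , from) =
  Occurrence⇒Contains ∘ to ∘ Contains⇒Occurrence , Occurrence⇒Contains ∘ from ∘ Contains⇒Occurrence

occurrence-∷ʳ : ∀ {x α β} → Occurrence α β → Occurrence (x ∷ α) β
occurrence-∷ʳ {x} (occurrence s⊆α s≅β) = occurrence (x ∷ʳ s⊆α) s≅β

occurrence-∷⁻ : ∀ {α b β} → Occurrence α (b ∷ β) → Occurrence α β
occurrence-∷⁻ (occurrence {[]} _ (() , _))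
occurrence-∷⁻ (occurrence {_ ∷ _} s⊆α s≅β) = occurrence (∷ˡ⁻ s⊆α) (orderIso-∷⁻ s≅β)

¬max∷≅ascent : ∀ {x σ s k₁ k₂ τ} → k₁ < k₂ → All (_< x) σ → s ⊆ σ →
  ¬ OrderIso (x ∷ s) (k₁ ∷ k₂ ∷ τ)
¬max∷≅ascent {s = []} _ _ _ (() , _)
¬max∷≅ascent {s = _ ∷ _} k₁<k₂ σ<x s⊆σ (_ , iso) =
  <-asym (All.head (All-resp-⊆ s⊆σ σ<x)) (proj₂ (iso fzero (fsuc fzero)) k₁<k₂)

¬ascent≅max∷ : ∀ {y x s k τ} → y < x → All (_< k) τ → ¬ OrderIso (y ∷ x ∷ s) (k ∷ τ)
¬ascent≅max∷ {τ = []} _ _ (() , _)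
¬ascent≅max∷ {τ = _ ∷ _} y<x (t<k ∷ _) (_ , iso) =
  <-asym t<k (proj₁ (iso fzero (fsuc fzero)) y<x)

occurrence-max∷⇔ : ∀ {x σ k τ} → All (_< x) σ → All (_< k) τ →
  Occurrence (x ∷ σ) (k ∷ τ) ⟺ Occurrence σ τ
occurrence-max∷⇔ {x} {σ} {k} {τ} σ<x τ<k = to , from
  where
  to : Occurrence (x ∷ σ) (k ∷ τ) → Occurrence σ τ
  to (occurrence (_ ∷ʳ s⊆σ) s≅kτ) = occurrence-∷⁻ (occurrence s⊆σ s≅kτ)
  to (occurrence (refl ∷ s⊆σ) xs≅kτ) = occurrence s⊆σ (orderIso-∷⁻ xs≅kτ)
  from : Occurrence σ τ → Occurrence (x ∷ σ) (k ∷ τ)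
  from (occurrence s⊆σ s≅τ) =
    occurrence (refl ∷ s⊆σ) (orderIso-max∷ s≅τ (All-resp-⊆ s⊆σ σ<x) τ<k)

occurrence-∷max∷⇔ : ∀ {y x σ k τ} → y < x → All (_< x) σ → All (_< k) τ →
  Occurrence (y ∷ x ∷ σ) (k ∷ τ) ⟺ Occurrence σ τ
occurrence-∷max∷⇔ {y} {x} {σ} {k} {τ} y<x σ<x τ<k = to , occurrence-∷ʳ ∘ proj₂ x-first
  where
  x-first = occurrence-max∷⇔ σ<x τ<k
  to : Occurrence (y ∷ x ∷ σ) (k ∷ τ) → Occurrence σ τ
  to (occurrence (_ ∷ʳ s⊆xσ) s≅kτ) = proj₁ x-first (occurrence s⊆xσ s≅kτ)
  to (occurrence (refl ∷ _ ∷ʳ s⊆σ) ys≅kτ) = occurrence s⊆σ (orderIso-∷⁻ ys≅kτ)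
  to (occurrence (refl ∷ refl ∷ _) yxs≅kτ) = contradiction yxs≅kτ (¬ascent≅max∷ y<x τ<k)

occurrence-max∷-ascent⇔ : ∀ {x σ k₁ k₂ τ} → k₁ < k₂ → All (_< x) σ →
  Occurrence (x ∷ σ) (k₁ ∷ k₂ ∷ τ) ⟺ Occurrence σ (k₁ ∷ k₂ ∷ τ)
occurrence-max∷-ascent⇔ {x} {σ} {k₁} {k₂} {τ} k₁<k₂ σ<x = to , occurrence-∷ʳ
  where
  to : Occurrence (x ∷ σ) (k₁ ∷ k₂ ∷ τ) → Occurrence σ (k₁ ∷ k₂ ∷ τ)
  to (occurrence (_ ∷ʳ s⊆σ) s≅kτ) = occurrence s⊆σ s≅kτ
  to (occurrence (refl ∷ s⊆σ) xs≅kτ) =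
    contradiction xs≅kτ (¬max∷≅ascent k₁<k₂ σ<x s⊆σ)

occurrence-ascent∷⇔ : ∀ {y x σ k₁ k₂ τ} → y < x → k₁ < k₂ → All (_< y) σ → All (_< k₁) τ →
  Occurrence (y ∷ x ∷ σ) (k₁ ∷ k₂ ∷ τ) ⟺ Occurrence σ τ
occurrence-ascent∷⇔ {y} {x} {σ} {k₁} {k₂} {τ} y<x k₁<k₂ σ<y τ<k₁ = to , from
  where
  σ<x = All<-trans σ<y y<x
  τ<k₂ = All<-trans τ<k₁ k₁<k₂
  to : Occurrence (y ∷ x ∷ σ) (k₁ ∷ k₂ ∷ τ) → Occurrence σ τ
  to (occurrence (_ ∷ʳ s⊆xσ) s≅kτ) =
    occurrence-∷⁻ (occurrence-∷⁻ (proj₁ (occurrence-max∷-ascent⇔ k₁<k₂ σ<x) (occurrence s⊆xσ s≅kτ)))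
  to (occurrence (refl ∷ _ ∷ʳ s⊆σ) ys≅kτ) =
    contradiction ys≅kτ (¬max∷≅ascent k₁<k₂ σ<y s⊆σ)
  to (occurrence (refl ∷ refl ∷ s⊆σ) yxs≅kτ) =
    occurrence s⊆σ (orderIso-∷⁻ (orderIso-∷⁻ yxs≅kτ))
  from : Occurrence σ τ → Occurrence (y ∷ x ∷ σ) (k₁ ∷ k₂ ∷ τ)
  from (occurrence s⊆σ s≅τ) = occurrence (refl ∷ refl ∷ s⊆σ)
    (orderIso-∷ (orderIso-max∷ s≅τ (All-resp-⊆ s⊆σ σ<x) τ<k₂)
                (above y<x k₁<k₂ ∷ below-all (proj₁ s≅τ) (All-resp-⊆ s⊆σ σ<y) τ<k₁))

occurrence-∷ʳ⁻ : ∀ {x α b₁ b₂ b₃} → b₁ < b₃ → All (_< x) (drop 1 α) →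
  Occurrence (x ∷ α) (b₁ ∷ b₂ ∷ b₃ ∷ []) → Occurrence α (b₁ ∷ b₂ ∷ b₃ ∷ [])
occurrence-∷ʳ⁻ _ _ (occurrence (_ ∷ʳ s⊆α) s≅β) = occurrence s⊆α s≅β
occurrence-∷ʳ⁻ {α = _ ∷ _} b₁<b₃ tail<x (occurrence {_ ∷ _ ∷ _ ∷ []} (refl ∷ s⊆α) (_ , iso)) =
  contradiction (proj₂ (iso fzero (fsuc (fsuc fzero))) b₁<b₃)
                (<-asym (All.head (All-resp-⊆ (∷⁻ s⊆α) tail<x)))
occurrence-∷ʳ⁻ _ _ (occurrence {_ ∷ []} (refl ∷ _) (() , _))
occurrence-∷ʳ⁻ _ _ (occurrence {_ ∷ _ ∷ []} (refl ∷ _) (() , _))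
occurrence-∷ʳ⁻ _ _ (occurrence {_ ∷ _ ∷ _ ∷ _ ∷ _} (refl ∷ _) (() , _))

avoidsAll-∷⁻ : ∀ {T x α} → AvoidsAll T (x ∷ α) → AvoidsAll T α
avoidsAll-∷⁻ {x = x} {α} =
  All.map λ {β} ¬xα⊒β → ¬xα⊒β ∘ Occurrence⇒Contains ∘ occurrence-∷ʳ {x} {α} {β} ∘ Contains⇒Occurrence

-- The last entry of a length-3 occurrence starting at x lies in drop 1 α, hence below x, while every
-- pattern of T₀ ends above its first entry.
avoidsT₀-∷ : ∀ {x α} → All (_< x) (drop 1 α) → AvoidsAll T₀ α → AvoidsAll T₀ (x ∷ α)
avoidsT₀-∷ {x} {α} tail<x (¬123 ∷ ¬132 ∷ ¬213 ∷ []) =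
  extend (s<s z<s) ¬123 ∷ extend (s<s z<s) ¬132 ∷ extend (s<s (s<s z<s)) ¬213 ∷ []
  where
  extend : ∀ {b₁ b₂ b₃} → b₁ < b₃ →
    ¬ Contains α (b₁ ∷ b₂ ∷ b₃ ∷ []) → ¬ Contains (x ∷ α) (b₁ ∷ b₂ ∷ b₃ ∷ [])
  extend {b₂ = b₂} b₁<b₃ ¬α⊒β =
    ¬α⊒β ∘ Occurrence⇒Contains ∘ occurrence-∷ʳ⁻ {α = α} {b₂ = b₂} b₁<b₃ tail<x ∘ Contains⇒Occurrence

InS-max∷⁻ : ∀ {n σ} → InS (suc n) T₀ (suc n ∷ σ) → InS n T₀ σ
InS-max∷⁻ {σ = σ} (perm , avoids) = IsPerm-max∷⁻ perm , avoidsAll-∷⁻ {α = σ} avoids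

InS-max∷⁺ : ∀ {n σ} → InS n T₀ σ → InS (suc n) T₀ (suc n ∷ σ)
InS-max∷⁺ {σ = σ} (perm , avoids) =
  IsPerm-max∷⁺ perm , avoidsT₀-∷ {α = σ} (drop⁺ 1 (IsPerm⇒All< perm)) avoids

InS-pair⁻ : ∀ {m σ} → InS (suc (suc m)) T₀ (suc m ∷ suc (suc m) ∷ σ) → InS m T₀ σ
InS-pair⁻ {m} {σ} (perm , avoids) =
  IsPerm-max∷⁻ (IsPerm-max∷⁻ (IsPerm-swap perm)) ,
  avoidsAll-∷⁻ {α = σ} (avoidsAll-∷⁻ {α = suc (suc m) ∷ σ} avoids)

InS-pair⁺ : ∀ {m σ} → InS m T₀ σ → InS (suc (suc m)) T₀ (suc m ∷ suc (suc m) ∷ σ)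
InS-pair⁺ {m} {σ} (perm , avoids) =
  IsPerm-swap (IsPerm-max∷⁺ (IsPerm-max∷⁺ perm)) ,
  avoidsT₀-∷ {α = suc (suc m) ∷ σ} σ<1+m
    (avoidsT₀-∷ {α = σ} (drop⁺ 1 (All<-trans σ<1+m (n<1+n (suc m)))) avoids)
  where σ<1+m = IsPerm⇒All< perm

contains-∷∷-∈ : ∀ {a b c ρ} β → OrderIso (a ∷ b ∷ c ∷ []) β → c ∈ ρ → Contains (a ∷ b ∷ ρ) β
contains-∷∷-∈ β abc≅β c∈ρ =
  Occurrence⇒Contains {β = β} (occurrence (refl ∷ refl ∷ from∈ c∈ρ) abc≅β)

contains-123-or-213 : ∀ {a b c ρ} → a ≢ b → a < c → b < c → c ∈ ρ →
  Contains (a ∷ b ∷ ρ) (1 ∷ 2 ∷ 3 ∷ []) ⊎ Contains (a ∷ b ∷ ρ) (2 ∷ 1 ∷ 3 ∷ [])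
contains-123-or-213 {a} {b} a≢b a<c b<c c∈ρ with <-cmp a b
... | tri< a<b _ _ = inj₁ (contains-∷∷-∈ _ (orderIso-123 a<b b<c) c∈ρ)
... | tri≈ _ a≡b _ = contradiction a≡b a≢b
... | tri> _ _ b<a = inj₂ (contains-∷∷-∈ _ (orderIso-213 b<a a<c) c∈ρ)

T₀-avoider-max-position : ∀ {n α} → InS (suc n) T₀ α →
  (Σ (List ℕ) λ σ → α ≡ suc n ∷ σ) ⊎ (Σ ℕ λ a → Σ (List ℕ) λ σ → α ≡ a ∷ suc n ∷ σ)
T₀-avoider-max-position {n} {a ∷ ρ} (perm , avoids) with IsPerm-∈ perm (s≤s z≤n) ≤-refl
... | here refl = inj₁ (ρ , refl)
... | there (here refl) = inj₂ (a , _ , refl)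
T₀-avoider-max-position {n} {a ∷ b ∷ ρ}
  ((_ , (_ , a≤1+n) ∷ (_ , b≤1+n) ∷ _ , (a∉bρ ∷ b∉ρ ∷ _)) , ¬123 ∷ _ ∷ ¬213 ∷ []) | there (there 1+n∈ρ) =
  ⊥-elim ([ ¬123 , ¬213 ]′ (contains-123-or-213 (All.head a∉bρ) a<1+n b<1+n 1+n∈ρ))
  where
  a<1+n = ≤∧≢⇒< a≤1+n (All.lookup a∉bρ (there 1+n∈ρ))
  b<1+n = ≤∧≢⇒< b≤1+n (All.lookup b∉ρ 1+n∈ρ)

T₀-avoider-pair-head : ∀ {m a σ} → InS (suc (suc m)) T₀ (a ∷ suc (suc m) ∷ σ) → a ≡ suc m
T₀-avoider-pair-head {m} (perm@(_ , (_ , a≤2+m) ∷ _ , (a∉ ∷ _)) , _ ∷ ¬132 ∷ _)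
  with IsPerm-∈ perm (s≤s z≤n) (n≤1+n (suc m))
... | here 1+m≡a = sym 1+m≡a
... | there (here 1+m≡2+m) = contradiction 1+m≡2+m (<⇒≢ (n<1+n (suc m)))
... | there (there 1+m∈σ) =
  contradiction (contains-∷∷-∈ _ (orderIso-132 a<1+m (n<1+n (suc m))) 1+m∈σ) ¬132
  where a<1+m = ≤∧≢⇒< (≤-pred (≤∧≢⇒< a≤2+m (All.head a∉))) (All.lookup a∉ (there 1+m∈σ))

T₀-avoider-shape : ∀ {m α} → InS (suc (suc m)) T₀ α →
  (Σ (List ℕ) λ σ → α ≡ suc (suc m) ∷ σ) ⊎ (Σ (List ℕ) λ σ → α ≡ suc m ∷ suc (suc m) ∷ σ)
T₀-avoider-shape α∈S with T₀-avoider-max-position α∈S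
... | inj₁ max-first = inj₁ max-first
... | inj₂ (_ , σ , refl) with T₀-avoider-pair-head α∈S
...   | refl = inj₂ (σ , refl)

S-decomposition : ∀ {m P Q R} →
  (∀ {σ} → IsPerm (suc m) σ → Contains (suc (suc m) ∷ σ) P ⟺ Contains σ Q) →
  (∀ {σ} → IsPerm m σ → Contains (suc m ∷ suc (suc m) ∷ σ) P ⟺ Contains σ R) →
  countS (suc (suc m)) (P ∷ T₀) ≡ countS (suc m) (Q ∷ T₀) + countS m (R ∷ T₀)
S-decomposition {m} {P} {Q} {R} P⇔Q P⇔R =
  count-split (suc (suc m) ∷_) (λ σ → suc m ∷ suc (suc m) ∷ σ)
              ∷-injectiveʳ (∷-injectiveʳ ∘ ∷-injectiveʳ) heads-differ (to , from)
  where
  heads-differ : ∀ {σ τ} → suc (suc m) ∷ σ ≢ suc m ∷ suc (suc m) ∷ τ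
  heads-differ eq = <⇒≢ (n<1+n (suc m)) (sym (∷-injectiveˡ eq))
  Split : List ℕ → Set
  Split α = (Σ (List ℕ) λ σ → α ≡ suc (suc m) ∷ σ × InS (suc m) (Q ∷ T₀) σ)
          ⊎ (Σ (List ℕ) λ σ → α ≡ suc m ∷ suc (suc m) ∷ σ × InS m (R ∷ T₀) σ)
  to : ∀ {α} → InS (suc (suc m)) (P ∷ T₀) α → Split α
  to (perm , ¬P ∷ avoids) with T₀-avoider-shape (perm , avoids)
  ... | inj₁ (σ , refl) = let (σ-perm , σ-avoids) = InS-max∷⁻ (perm , avoids) in
    inj₁ (σ , refl , σ-perm , (¬P ∘ proj₂ (P⇔Q σ-perm)) ∷ σ-avoids)
  ... | inj₂ (σ , refl) = let (σ-perm , σ-avoids) = InS-pair⁻ (perm , avoids) in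
    inj₂ (σ , refl , σ-perm , (¬P ∘ proj₂ (P⇔R σ-perm)) ∷ σ-avoids)
  from : ∀ {α} → Split α → InS (suc (suc m)) (P ∷ T₀) α
  from (inj₁ (σ , refl , σ-perm , ¬Q ∷ σ-avoids)) =
    let (perm , avoids) = InS-max∷⁺ (σ-perm , σ-avoids) in perm , (¬Q ∘ proj₁ (P⇔Q σ-perm)) ∷ avoids
  from (inj₂ (σ , refl , σ-perm , ¬R ∷ σ-avoids)) =
    let (perm , avoids) = InS-pair⁺ (σ-perm , σ-avoids) in perm , (¬R ∘ proj₁ (P⇔R σ-perm)) ∷ avoids

recurrence-max∷ : ∀ {k τ′} → IsPerm k τ′ → ∀ m →
  countS (suc (suc m)) ((suc k ∷ τ′) ∷ T₀) ≡ countS (suc m) (τ′ ∷ T₀) + countS m (τ′ ∷ T₀)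
recurrence-max∷ τ′-perm m = S-decomposition
  (λ σ-perm → Contains-⟺ (occurrence-max∷⇔ (IsPerm⇒All< σ-perm) τ′<1+k))
  (λ σ-perm → Contains-⟺ (occurrence-∷max∷⇔ 1+m<2+m (All<-trans (IsPerm⇒All< σ-perm) 1+m<2+m) τ′<1+k))
  where
  τ′<1+k = IsPerm⇒All< τ′-perm
  1+m<2+m = n<1+n (suc m)

recurrence-pair : ∀ {k τ″} → IsPerm k τ″ → ∀ m →
  countS (suc (suc m)) ((suc k ∷ suc (suc k) ∷ τ″) ∷ T₀)
    ≡ countS (suc m) ((suc k ∷ suc (suc k) ∷ τ″) ∷ T₀) + countS m (τ″ ∷ T₀)
recurrence-pair {k} τ″-perm m = S-decomposition
  (λ σ-perm → Contains-⟺ (occurrence-max∷-ascent⇔ (n<1+n (suc k)) (IsPerm⇒All< σ-perm)))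
  (λ σ-perm → Contains-⟺
    (occurrence-ascent∷⇔ (n<1+n (suc m)) (n<1+n (suc k)) (IsPerm⇒All< σ-perm) (IsPerm⇒All< τ″-perm)))

at-least-two : ∀ {k} {P : ℕ → Set} → (∀ m → P (suc (suc m))) → ∀ n → n ≥ suc (suc k) → P n
at-least-two P[2+m] (suc (suc m)) _ = P[2+m] m
at-least-two _ (suc zero) (s≤s ())

lemma3 : (k : ℕ) → k ≥ 1 → (τ : List ℕ) → InS k T₀ τ → ¬ (τ ≡ decreasing k) →
  (Σ (List ℕ) λ τ′ → τ ≡ k ∷ τ′ × InS (k ∸ 1) T₀ τ′ ×
     ((n : ℕ) → n ≥ k →
        countS n (τ ∷ T₀) ≡ countS (n ∸ 1) (τ′ ∷ T₀) + countS (n ∸ 2) (τ′ ∷ T₀)))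
  ⊎
  (Σ (List ℕ) λ τ″ → τ ≡ (k ∸ 1) ∷ k ∷ τ″ × InS (k ∸ 2) T₀ τ″ ×
     ((n : ℕ) → n ≥ k →
        countS n (τ ∷ T₀) ≡ countS (n ∸ 1) (τ ∷ T₀) + countS (n ∸ 2) (τ″ ∷ T₀)))
lemma3 (suc zero) _ τ (perm , _) τ≢1 = contradiction (IsPerm-1 perm) τ≢1
lemma3 (suc (suc k)) _ τ τ∈S _ with T₀-avoider-shape τ∈S
... | inj₁ (τ′ , refl) = let τ′∈S = InS-max∷⁻ τ∈S in
  inj₁ (τ′ , refl , τ′∈S , at-least-two (recurrence-max∷ (proj₁ τ′∈S)))
... | inj₂ (τ″ , refl) = let τ″∈S = InS-pair⁻ τ∈S in
  inj₂ (τ″ , refl , τ″∈S , at-least-two (recurrence-pair (proj₁ τ″∈S)))
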